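{- For an integer $n\ge 2$, the maximum of the Mostar index $\mathrm{Mo}(K_{x,n-x})$ over all complete bipartite graphs $K_{x,n-x}$ of order $n$ (with $1\le x\le n-1$) equals $\frac{n^3}{6\sqrt{3}}-O(n)$.
   Context: For a graph $G$ and an edge $\{u,v\}\in E(G)$, let $n_G(u,v)$ denote the number of vertices of $G$ that are strictly closer to $u$ than to $v$. The Mostar index of $G$ is $\mathrm{Mo}(G)=\sum_{\{u,v\}\in E(G)}|n_G(u,v)-n_G(v,u)|$. -}

module Defs where

open import Data.Bool.Base using (Bool; true; false; _∧_; _∨_; _xor_; if_then_else_)
open import Data.Nat.Base using (ℕ; zero; suc; _+_; _*_; _∸_; _<ᵇ_; _≡ᵇ_; _⊔_; ∣_-_∣)
open import Data.Fin.Base using (Fin; toℕ)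
open import Data.List.Base using (List; []; _∷_; map; foldr; allFin; upTo; concatMap)
open import Data.Nat.ListAction using (sum)
open import Data.Bool.ListAction using (any)

-- A (simple, undirected) graph on the vertex set Fin n, given by a Boolean
-- adjacency function (assumed symmetric and irreflexive for the graphs used).
record Graph (n : ℕ) : Set where
  field
    adj : Fin n → Fin n → Bool
open Graph public

_==_ : ∀ {n} → Fin n → Fin n → Bool
i == j = toℕ i ≡ᵇ toℕ j

reach : ∀ {n} → Graph n → ℕ → Fin n → Fin n → Bool
reach G zero    u w = u == w
reach {n} G (suc k) u w = reach G k u w ∨ any (λ z → reach G k u z ∧ adj G z w) (allFin n)

-- shortest-path distance: least k < n with reach k; if none (disconnected),
-- the sentinel value n (larger than every finite distance).
distFrom : ∀ {n} → Graph n → ℕ → ℕ → Fin n → Fin n → ℕ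
distFrom G k zero      u w = k
distFrom G k (suc fuel) u w = if reach G k u w then k else distFrom G (suc k) fuel u w

dist : ∀ {n} → Graph n → Fin n → Fin n → ℕ
dist {n} G u w = distFrom G 0 n u w

nG : ∀ {n} → Graph n → Fin n → Fin n → ℕ
nG {n} G u v = sum (map (λ w → if dist G u w <ᵇ dist G v w then 1 else 0) (allFin n))

mostar : ∀ {n} → Graph n → ℕ
mostar {n} G = sum (concatMap (λ u → map (λ v →
    if adj G u v ∧ (toℕ u <ᵇ toℕ v) then ∣ nG G u v - nG G v u ∣ else 0)
  (allFin n)) (allFin n))

completeBipartite : (n x : ℕ) → Graph n
completeBipartite n x = record { adj = λ i j → (toℕ i <ᵇ x) xor (toℕ j <ᵇ x) }

maxMoBipartite : ℕ → ℕ
maxMoBipartite n = foldr _⊔_ 0 (map (λ x → mostar (completeBipartite n x)) (map suc (upTo (n ∸ 1))))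

-- In K_{a,b} the vertices strictly closer to u than to v, for an edge uv, are u and the
-- rest of v's side, so n(u,v) is the size of v's side and Mo(K_{a,b}) = |a − b|·a·b.
-- Write the parts as x and x + q, so that n = 2x + q.  A polynomial identity expresses
-- n⁶ − 108 Mo² as (2x(x+q) − q²)² times a factor of order n², so 108 Mo² ≤ n⁶, that is
-- Mo ≤ n³/(6√3); choosing q of the parity of n with 3q² ≤ n² ≤ 3q² + 12n makes that
-- term O(n⁴), whence max Mo ≥ n³/(6√3) − O(n).
module Submission where

open import Defs
open import Data.Bool.Base using (Bool; true; false; not; _∧_; _∨_; _xor_; if_then_else_; T)
open import Data.Bool.ListAction using (any; or)
open import Data.Bool.Properties using (∨-identityʳ; not-¬)
open import Data.Fin.Base using (Fin; zero; suc; toℕ)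
open import Data.List.Base using (List; []; _∷_; map; tabulate; allFin; concatMap; upTo; foldr)
open import Data.List.Membership.Propositional using (_∈_)
open import Data.List.Membership.Propositional.Properties
  using (∈-map⁺; ∈-map⁻; ∈-upTo⁺; ∈-upTo⁻; foldr-selective)
open import Data.List.Properties using (map-tabulate; foldr-forcesᵇ)
open import Data.List.Relation.Unary.All as All using ()
open import Data.Nat.Base
open import Data.Nat.ListAction using (sum)
open import Data.Nat.ListAction.Properties using (sum-++)
open import Data.Nat.Properties
open import Algebra.Properties.Semiring.Sum +-*-semiring
  using (sum-syntax; sum-cong-≗; ∑-distrib-+; *-distribˡ-sum; *-distribʳ-sum; sum-replicate-zero)
  renaming (sum to ∑)
open import Data.Nat.Solver using (module +-*-Solver)
open import Data.Product.Base using (∃-syntax; _×_; _,_)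
open import Data.Sum.Base using (inj₁; inj₂; [_,_]′)
open import Function.Base using (id; _∘_)
open import Relation.Binary.PropositionalEquality
  using (_≡_; refl; sym; trans; cong; cong₂; subst; subst₂; module ≡-Reasoning)
open import Relation.Nullary.Decidable using (Dec; yes; no)
open import Relation.Nullary.Negation using (contradiction)
open +-*-Solver

[_] : Bool → ℕ
[ b ] = if b then 1 else 0

sum-tabulate : ∀ {n} (f : Fin n → ℕ) → sum (tabulate f) ≡ ∑ f
sum-tabulate {zero}  f = refl
sum-tabulate {suc n} f = cong (f zero +_) (sum-tabulate (f ∘ suc))

sum-map-allFin : ∀ {n} (f : Fin n → ℕ) → sum (map f (allFin n)) ≡ ∑ f
sum-map-allFin f = trans (cong sum (map-tabulate id f)) (sum-tabulate f)

sum-concatMap : ∀ {A : Set} (f : A → List ℕ) xs → sum (concatMap f xs) ≡ sum (map (sum ∘ f) xs)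
sum-concatMap f []       = refl
sum-concatMap f (x ∷ xs) = trans (sum-++ (f x) (concatMap f xs)) (cong (sum (f x) +_) (sum-concatMap f xs))

∑-*-∑ : ∀ {m n} (f : Fin m → ℕ) (g : Fin n → ℕ) → ∑[ i < m ] ∑[ j < n ] (f i * g j) ≡ ∑ f * ∑ g
∑-*-∑ f g = trans (sum-cong-≗ (λ i → sym (*-distribˡ-sum (f i) g))) (sym (*-distribʳ-sum (∑ g) f))

∑-[==] : ∀ {n} (u : Fin n) → ∑[ w < n ] [ u == w ] ≡ 1
∑-[==] {suc n} zero    = cong suc (sum-replicate-zero n)
∑-[==] {suc n} (suc u) = ∑-[==] u

∑-[<x] : ∀ {n} x → x ≤ n → ∑[ i < n ] [ toℕ i <ᵇ x ] ≡ x
∑-[<x] {n}     zero    _         = sum-replicate-zero n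
∑-[<x] {suc n} (suc x) (s≤s x≤n) = cong suc (∑-[<x] x x≤n)

∑-[≥x] : ∀ {n} x → x ≤ n → ∑[ i < n ] [ not (toℕ i <ᵇ x) ] ≡ n ∸ x
∑-[≥x] {zero}  zero    _         = refl
∑-[≥x] {suc n} zero    _         = cong suc (∑-[≥x] zero z≤n)
∑-[≥x] {suc n} (suc x) (s≤s x≤n) = ∑-[≥x] x x≤n

any-==-∧ : ∀ {n} (u : Fin n) (p : Fin n → Bool) → any (λ w → (u == w) ∧ p w) (allFin n) ≡ p u
any-==-∧ {n} u p = trans (cong or (map-tabulate id (λ w → (u == w) ∧ p w))) (or-tabulate u p)
  where
  or-false : ∀ {n} → or (tabulate {n = n} (λ _ → false)) ≡ false
  or-false {zero}  = refl
  or-false {suc n} = or-false {n}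
  or-tabulate : ∀ {n} (u : Fin n) (p : Fin n → Bool) → or (tabulate (λ w → (u == w) ∧ p w)) ≡ p u
  or-tabulate {suc n} zero    p = trans (cong (p zero ∨_) (or-false {n})) (∨-identityʳ (p zero))
  or-tabulate {suc n} (suc u) p = or-tabulate u (p ∘ suc)

distFrom-≥ : ∀ {n} (G : Graph n) k fuel u w → k ≤ distFrom G k fuel u w
distFrom-≥ G k zero       u w = ≤-refl
distFrom-≥ G k (suc fuel) u w with reach G k u w
... | true  = ≤-refl
... | false = ≤-trans (n≤1+n k) (distFrom-≥ G (suc k) fuel u w)

dist-unfold : ∀ {m} (G : Graph (suc (suc m))) u w →
  dist G u w ≡ (if u == w then 0 else if adj G u w then 1 else distFrom G 2 m u w)
dist-unfold G u w rewrite any-==-∧ u (λ z → adj G z w) with u == w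
... | true  = refl
... | false = refl

-- a and b say whether w is u or v; s, s′ and t are the sides of u, v and w; d₁ and d₂ are
-- distances between distinct vertices of one side.
closer-table : ∀ a b s t {s′ d₁ d₂} → s′ ≡ not s → 2 ≤ d₁ → 2 ≤ d₂ → (T a → t ≡ s) → (T b → t ≡ s′) →
  [ (if a then 0 else if s xor t then 1 else d₁) <ᵇ (if b then 0 else if s′ xor t then 1 else d₂) ] + [ b ]
    ≡ [ a ] + [ s xor t ]
closer-table true  true  s     t     refl _             _             ha hb = contradiction (trans (sym (ha _)) (hb _)) (not-¬ refl)
closer-table true  false true  true  refl _             _             _  _  = refl
closer-table true  false false false refl _             _             _  _  = refl
closer-table true  false true  false refl _             _             ha _  = contradiction (ha _) λ ()
closer-table true  false false true  refl _             _             ha _  = contradiction (ha _) λ ()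
closer-table false true  true  false refl _             _             _  _  = refl
closer-table false true  false true  refl _             _             _  _  = refl
closer-table false true  true  true  refl _             _             _  hb = contradiction (hb _) λ ()
closer-table false true  false false refl _             _             _  hb = contradiction (hb _) λ ()
closer-table false false true  true  refl (s≤s (s≤s _)) _             _  _  = refl
closer-table false false false false refl (s≤s (s≤s _)) _             _  _  = refl
closer-table false false true  false refl _             (s≤s (s≤s _)) _  _  = refl
closer-table false false false true  refl _             (s≤s (s≤s _)) _  _  = refl

module CompleteBipartite (m x : ℕ) where

  n : ℕ
  n = suc (suc m)

  G : Graph n
  G = completeBipartite n x

  side : Fin n → Bool
  side i = toℕ i <ᵇ x

  side-== : ∀ {u w} → T (u == w) → side w ≡ side u
  side-== {u} {w} u≡w = cong (_<ᵇ x) (sym (≡ᵇ⇒≡ (toℕ u) (toℕ w) u≡w))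

  closer+[v==w] : ∀ {u v} → side v ≡ not (side u) → ∀ w →
    [ dist G u w <ᵇ dist G v w ] + [ v == w ] ≡ [ u == w ] + [ adj G u w ]
  closer+[v==w] {u} {v} opposite w rewrite dist-unfold G u w | dist-unfold G v w =
    closer-table (u == w) (v == w) (side u) (side w) opposite
      (distFrom-≥ G 2 m u w) (distFrom-≥ G 2 m v w) side-== side-==

  nG≡degree : ∀ {u v} → side v ≡ not (side u) → nG G u v ≡ ∑[ w < n ] [ adj G u w ]
  nG≡degree {u} {v} opposite = +-cancelʳ-≡ 1 _ _ (begin
    nG G u v + 1                                         ≡⟨ cong₂ _+_ (sum-map-allFin closer) (sym (∑-[==] v)) ⟩
    ∑ closer + ∑[ w < n ] [ v == w ]                     ≡⟨ sym (∑-distrib-+ closer (λ w → [ v == w ])) ⟩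
    ∑[ w < n ] (closer w + [ v == w ])                   ≡⟨ sum-cong-≗ (closer+[v==w] opposite) ⟩
    ∑[ w < n ] ([ u == w ] + [ adj G u w ])              ≡⟨ ∑-distrib-+ (λ w → [ u == w ]) (λ w → [ adj G u w ]) ⟩
    ∑[ w < n ] [ u == w ] + ∑[ w < n ] [ adj G u w ]    ≡⟨ cong (_+ ∑[ w < n ] [ adj G u w ]) (∑-[==] u) ⟩
    1 + ∑[ w < n ] [ adj G u w ]                         ≡⟨ +-comm 1 _ ⟩
    ∑[ w < n ] [ adj G u w ] + 1                         ∎)
    where
    open ≡-Reasoning
    closer : Fin n → ℕ
    closer w = [ dist G u w <ᵇ dist G v w ]

  degree : x ≤ n → ∀ u → ∑[ w < n ] [ adj G u w ] ≡ (if side u then n ∸ x else x)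
  degree x≤n u with side u
  ... | true  = ∑-[≥x] x x≤n
  ... | false = ∑-[<x] x x≤n

  side-true⇒< : ∀ {i} → side i ≡ true → toℕ i < x
  side-true⇒< {i} eq = <ᵇ⇒< (toℕ i) x (subst T (sym eq) _)

  side-false⇒≥ : ∀ {i} → side i ≡ false → x ≤ toℕ i
  side-false⇒≥ eq = ≮⇒≥ (λ i<x → subst T eq (<⇒<ᵇ i<x))

  nG-value : x ≤ n → ∀ {u v s} → side u ≡ s → side v ≡ not s → nG G u v ≡ (if s then n ∸ x else x)
  nG-value x≤n {u} refl opposite = trans (nG≡degree opposite) (degree x≤n u)

  gap : ℕ
  gap = ∣ (n ∸ x) - x ∣

  mostar-term : x ≤ n → ∀ u v →
    (if adj G u v ∧ (toℕ u <ᵇ toℕ v) then ∣ nG G u v - nG G v u ∣ else 0)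
      ≡ gap * [ side u ] * [ not (side v) ]
  mostar-term x≤n u v with side u in su | side v in sv | toℕ u <ᵇ toℕ v in u<ᵇv
  ... | true  | true  | _     = sym (*-zeroʳ (gap * 1))
  ... | false | false | _     = cong (_* 1) (sym (*-zeroʳ gap))
  ... | true  | false | true  = trans (cong₂ ∣_-_∣ (nG-value x≤n su sv) (nG-value x≤n sv su))
                                      (sym (trans (*-identityʳ _) (*-identityʳ _)))
  ... | true  | false | false = contradiction (<⇒<ᵇ (<-≤-trans (side-true⇒< su) (side-false⇒≥ sv))) (subst T u<ᵇv)
  ... | false | true  | true  = contradiction (<ᵇ⇒< (toℕ u) (toℕ v) (subst T (sym u<ᵇv) _))
                                              (≤⇒≯ (<⇒≤ (<-≤-trans (side-true⇒< sv) (side-false⇒≥ su))))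
  ... | false | true  | false = sym (*-zeroʳ (gap * 0))

  mostar-formula : x ≤ n → mostar G ≡ gap * ((n ∸ x) * x)
  mostar-formula x≤n = begin
    mostar G                                                ≡⟨ sum-concatMap (λ u → map (term u) (allFin n)) (allFin n) ⟩
    sum (map (λ u → sum (map (term u) (allFin n))) (allFin n)) ≡⟨ sum-map-allFin (λ u → sum (map (term u) (allFin n))) ⟩
    ∑[ u < n ] sum (map (term u) (allFin n))                ≡⟨ sum-cong-≗ (λ u → sum-map-allFin (term u)) ⟩
    ∑[ u < n ] ∑[ v < n ] term u v                          ≡⟨ sum-cong-≗ (λ u → sum-cong-≗ (mostar-term x≤n u)) ⟩
    ∑[ u < n ] ∑[ v < n ] (gap * [ side u ] * [ not (side v) ]) ≡⟨ ∑-*-∑ (λ u → gap * [ side u ]) (λ v → [ not (side v) ]) ⟩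
    ∑[ u < n ] (gap * [ side u ]) * ∑[ v < n ] [ not (side v) ] ≡⟨ cong₂ _*_ (sym (*-distribˡ-sum gap (λ u → [ side u ]))) (∑-[≥x] x x≤n) ⟩
    gap * ∑[ u < n ] [ side u ] * (n ∸ x)                   ≡⟨ cong (λ k → gap * k * (n ∸ x)) (∑-[<x] x x≤n) ⟩
    gap * x * (n ∸ x)                                       ≡⟨ trans (*-assoc gap x (n ∸ x)) (cong (gap *_) (*-comm x (n ∸ x))) ⟩
    gap * ((n ∸ x) * x)                                     ∎
    where
    open ≡-Reasoning
    term : Fin n → Fin n → ℕ
    term u v = if adj G u v ∧ (toℕ u <ᵇ toℕ v) then ∣ nG G u v - nG G v u ∣ else 0

m²+n²≡2mn+∣m-n∣² : ∀ m n → m ^ 2 + n ^ 2 ≡ 2 * m * n + ∣ m - n ∣ ^ 2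
m²+n²≡2mn+∣m-n∣² zero    n       = refl
m²+n²≡2mn+∣m-n∣² (suc m) zero    =
  solve 1 (λ a → a :^ 2 :+ con 0 := con 2 :* a :* con 0 :+ a :^ 2) refl (suc m)
m²+n²≡2mn+∣m-n∣² (suc m) (suc n) = begin
  suc m ^ 2 + suc n ^ 2                         ≡⟨ expand m n ⟩
  (m ^ 2 + n ^ 2) + 2 * (m + n + 1)             ≡⟨ cong (_+ 2 * (m + n + 1)) (m²+n²≡2mn+∣m-n∣² m n) ⟩
  (2 * m * n + ∣ m - n ∣ ^ 2) + 2 * (m + n + 1) ≡⟨ contract m n (∣ m - n ∣ ^ 2) ⟩
  2 * suc m * suc n + ∣ m - n ∣ ^ 2             ∎
  where
  open ≡-Reasoning
  expand : ∀ a b → suc a ^ 2 + suc b ^ 2 ≡ (a ^ 2 + b ^ 2) + 2 * (a + b + 1)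
  expand = solve 2 (λ a b → (con 1 :+ a) :^ 2 :+ (con 1 :+ b) :^ 2
                          := (a :^ 2 :+ b :^ 2) :+ con 2 :* (a :+ b :+ con 1)) refl
  contract : ∀ a b e → (2 * a * b + e) + 2 * (a + b + 1) ≡ 2 * suc a * suc b + e
  contract = solve 3 (λ a b e → (con 2 :* a :* b :+ e) :+ con 2 :* (a :+ b :+ con 1)
                              := con 2 :* (con 1 :+ a) :* (con 1 :+ b) :+ e) refl

∣m-n∣≤o : ∀ {m n o} → n ≤ m → m ≤ n + o → ∣ m - n ∣ ≤ o
∣m-n∣≤o {m} {n} {o} n≤m m≤n+o = begin
  ∣ m - n ∣ ≡⟨ m≤n⇒∣n-m∣≡n∸m n≤m ⟩
  m ∸ n     ≤⟨ ∸-monoˡ-≤ n m≤n+o ⟩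
  n + o ∸ n ≡⟨ m+n∸m≡n n o ⟩
  o         ∎
  where open ≤-Reasoning

-- In terms of n and q this is 4n⁶ = 27q²(n² − q²)² + (n² − 3q²)²(4n² − 3q²).
sextic-identity : ∀ x q → let n = x + (x + q) in
  n ^ 6 ≡ 108 * (q * (x * (x + q))) ^ 2
          + ∣ 2 * x * (x + q) - q ^ 2 ∣ ^ 2 * (n ^ 2 + 12 * x * (x + q))
sextic-identity x q = +-cancelʳ-≡ (2 * a * b * k) _ _ (begin
  n ^ 6 + 2 * a * b * k                      ≡⟨ expand x q ⟩
  108 * M ^ 2 + (a ^ 2 + b ^ 2) * k          ≡⟨ cong (λ t → 108 * M ^ 2 + t * k) (m²+n²≡2mn+∣m-n∣² a b) ⟩
  108 * M ^ 2 + (2 * a * b + d ^ 2) * k      ≡⟨ regroup (108 * M ^ 2) (2 * a * b) (d ^ 2) k ⟩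
  108 * M ^ 2 + d ^ 2 * k + 2 * a * b * k    ∎)
  where
  open ≡-Reasoning
  n = x + (x + q)
  a = 2 * x * (x + q)
  b = q ^ 2
  k = n ^ 2 + 12 * x * (x + q)
  M = q * (x * (x + q))
  d = ∣ a - b ∣
  expand : ∀ x q → let n = x + (x + q) ; a = 2 * x * (x + q) ; b = q ^ 2
                       k = n ^ 2 + 12 * x * (x + q) ; M = q * (x * (x + q)) in
           n ^ 6 + 2 * a * b * k ≡ 108 * M ^ 2 + (a ^ 2 + b ^ 2) * k
  expand = solve 2 (λ x q → let n = x :+ (x :+ q) ; a = con 2 :* x :* (x :+ q) ; b = q :^ 2
                                k = n :^ 2 :+ con 12 :* x :* (x :+ q) ; M = q :* (x :* (x :+ q)) in
                    n :^ 6 :+ con 2 :* a :* b :* k := con 108 :* M :^ 2 :+ (a :^ 2 :+ b :^ 2) :* k) refl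
  regroup : ∀ P Q R k → P + (Q + R) * k ≡ P + R * k + Q * k
  regroup = solve 4 (λ P Q R k → P :+ (Q :+ R) :* k := P :+ R :* k :+ Q :* k) refl

mostarK : ℕ → ℕ → ℕ
mostarK a b = ∣ a - b ∣ * (a * b)

mostarK-comm : ∀ a b → mostarK a b ≡ mostarK b a
mostarK-comm a b = cong₂ _*_ (∣-∣-comm a b) (*-comm a b)

mostarK-split : ∀ x q → mostarK (x + q) x ≡ q * (x * (x + q))
mostarK-split x q = cong₂ _*_ (trans (∣-∣-comm (x + q) x) (∣m-m+n∣≡n x q)) (*-comm (x + q) x)

mostar-completeBipartite : ∀ n x → x ≤ n → mostar (completeBipartite n x) ≡ mostarK (n ∸ x) x
mostar-completeBipartite zero          zero       _   = refl
mostar-completeBipartite (suc zero)    zero       _   = refl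
mostar-completeBipartite (suc zero)    (suc zero) _   = refl
mostar-completeBipartite (suc zero)    (suc (suc _)) (s≤s ())
mostar-completeBipartite (suc (suc m)) x          x≤n = CompleteBipartite.mostar-formula m x x≤n

mostarK-bound : ∀ a b → 108 * mostarK a b ^ 2 ≤ (a + b) ^ 6
mostarK-bound a b = [ ordered , (λ a≤b → subst₂ bound (mostarK-comm b a) (+-comm b a) (ordered a≤b)) ]′ (≤-total b a)
  where
  bound : ℕ → ℕ → Set
  bound m s = 108 * m ^ 2 ≤ s ^ 6
  ordered : ∀ {a b} → b ≤ a → bound (mostarK a b) (a + b)
  ordered {b = x} x≤a with m≤n⇒∃[o]m+o≡n x≤a
  ... | q , refl = subst₂ bound (sym (mostarK-split x q)) (+-comm x (x + q))
                     (≤-trans (m≤m+n _ _) (≤-reflexive (sym (sextic-identity x q))))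

balanced-bound : ∀ x q → let n = x + (x + q) in
  q ^ 2 ≤ 2 * x * (x + q) → 2 * x * (x + q) ≤ q ^ 2 + 6 * n →
  n ^ 6 ≤ 108 * (q * (x * (x + q))) ^ 2 + 144 * n ^ 4
balanced-bound x q b≤a a≤b+6n = begin
  n ^ 6                                    ≡⟨ sextic-identity x q ⟩
  108 * M ^ 2 + ∣ a - b ∣ ^ 2 * k          ≤⟨ +-monoʳ-≤ (108 * M ^ 2) (*-mono-≤ (^-monoˡ-≤ 2 (∣m-n∣≤o b≤a a≤b+6n)) k≤4n²) ⟩
  108 * M ^ 2 + (6 * n) ^ 2 * (4 * n ^ 2)  ≡⟨ cong (108 * M ^ 2 +_) (144n⁴ n) ⟩
  108 * M ^ 2 + 144 * n ^ 4                ∎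
  where
  open ≤-Reasoning
  n = x + (x + q)
  a = 2 * x * (x + q)
  b = q ^ 2
  k = n ^ 2 + 12 * x * (x + q)
  M = q * (x * (x + q))
  4n² : ∀ x q → 4 * (x + (x + q)) ^ 2 ≡ ((x + (x + q)) ^ 2 + 12 * x * (x + q)) + 3 * q ^ 2
  4n² = solve 2 (λ x q → con 4 :* (x :+ (x :+ q)) :^ 2
                       := ((x :+ (x :+ q)) :^ 2 :+ con 12 :* x :* (x :+ q)) :+ con 3 :* q :^ 2) refl
  k≤4n² : k ≤ 4 * n ^ 2
  k≤4n² = ≤-trans (m≤m+n k (3 * q ^ 2)) (≤-reflexive (sym (4n² x q)))
  144n⁴ : ∀ n → (6 * n) ^ 2 * (4 * n ^ 2) ≡ 144 * n ^ 4
  144n⁴ = solve 1 (λ n → (con 6 :* n) :^ 2 :* (con 4 :* n :^ 2) := con 144 :* n :^ 4) refl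

144n⁴≤43200n² : ∀ {n} → n ≤ 16 → 144 * n ^ 4 ≤ 43200 * n ^ 2
144n⁴≤43200n² {n} n≤16 = begin
  144 * n ^ 4           ≡⟨ cong (144 *_) (solve 1 (λ n → n :^ 4 := n :^ 2 :* n :^ 2) refl n) ⟩
  144 * (n ^ 2 * n ^ 2) ≤⟨ *-monoʳ-≤ 144 (*-monoˡ-≤ (n ^ 2) (^-monoˡ-≤ 2 n≤16)) ⟩
  144 * (256 * n ^ 2)   ≡⟨ sym (*-assoc 144 256 (n ^ 2)) ⟩
  36864 * n ^ 2         ≤⟨ *-monoˡ-≤ (n ^ 2) (m≤m+n 36864 6336) ⟩
  43200 * n ^ 2         ∎
  where open ≤-Reasoning

n³≤15m : ∀ {n m} → 16 < n → n ^ 6 ≤ 108 * m ^ 2 + 144 * n ^ 4 → n ^ 3 ≤ 15 * m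
n³≤15m {n} {m} 16<n n⁶≤ = ≮⇒≥ (λ 15m<n³ → <⇒≱ (^-monoˡ-< 2 15m<n³) (begin
  (n ^ 3) ^ 2  ≡⟨ solve 1 (λ n → (n :^ 3) :^ 2 := n :^ 6) refl n ⟩
  n ^ 6        ≤⟨ n⁶≤216m² ⟩
  216 * m ^ 2  ≤⟨ *-monoˡ-≤ (m ^ 2) (m≤m+n 216 9) ⟩
  15 * 15 * m ^ 2 ≡⟨ solve 2 (λ c m → c :* c :* m :^ 2 := (c :* m) :^ 2) refl 15 m ⟩
  (15 * m) ^ 2 ∎))
  where
  open ≤-Reasoning
  288n⁴≤n⁶ : 288 * n ^ 4 ≤ n ^ 6
  288n⁴≤n⁶ = begin
    288 * n ^ 4   ≤⟨ *-monoˡ-≤ (n ^ 4) (≤-trans (n≤1+n 288) (^-monoˡ-≤ 2 16<n)) ⟩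
    n ^ 2 * n ^ 4 ≡⟨ solve 1 (λ n → n :^ 2 :* n :^ 4 := n :^ 6) refl n ⟩
    n ^ 6         ∎
  n⁶≤216m² : n ^ 6 ≤ 216 * m ^ 2
  n⁶≤216m² = +-cancelʳ-≤ (n ^ 6) _ _ (begin
    n ^ 6 + n ^ 6                                             ≤⟨ +-mono-≤ n⁶≤ n⁶≤ ⟩
    (108 * m ^ 2 + 144 * n ^ 4) + (108 * m ^ 2 + 144 * n ^ 4) ≡⟨ double 108 144 (m ^ 2) (n ^ 4) ⟩
    2 * 108 * m ^ 2 + 2 * 144 * n ^ 4                         ≤⟨ +-monoʳ-≤ (216 * m ^ 2) 288n⁴≤n⁶ ⟩
    216 * m ^ 2 + n ^ 6                                       ∎)
    where
    double : ∀ c d a b → (c * a + d * b) + (c * a + d * b) ≡ 2 * c * a + 2 * d * b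
    double = solve 4 (λ c d a b → (c :* a :+ d :* b) :+ (c :* a :+ d :* b)
                                := con 2 :* c :* a :+ con 2 :* d :* b) refl

-- For n ≤ 16 the term 20n alone absorbs 144n⁴; beyond that the hypothesis forces m ≥ n³/15.
n⁶≤[m+20n]² : ∀ n m → n ^ 6 ≤ 108 * m ^ 2 + 144 * n ^ 4 → n ^ 6 ≤ 108 * (m + 20 * n) ^ 2
n⁶≤[m+20n]² n m n⁶≤ = begin
  n ^ 6                                        ≤⟨ n⁶≤ ⟩
  108 * m ^ 2 + 144 * n ^ 4                    ≤⟨ +-monoʳ-≤ (108 * m ^ 2) quartic ⟩
  108 * m ^ 2 + (216 * 20 * m * n + 108 * (20 * 20) * n ^ 2) ≡⟨ square m n 20 ⟩
  108 * (m + 20 * n) ^ 2                       ∎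
  where
  open ≤-Reasoning
  square : ∀ m n c → 108 * m ^ 2 + (216 * c * m * n + 108 * (c * c) * n ^ 2) ≡ 108 * (m + c * n) ^ 2
  square = solve 3 (λ m n c → con 108 :* m :^ 2 :+ (con 216 :* c :* m :* n :+ con 108 :* (c :* c) :* n :^ 2)
                            := con 108 :* (m :+ c :* n) :^ 2) refl
  large : 16 < n → 144 * n ^ 4 ≤ 4320 * m * n
  large 16<n = begin
    144 * n ^ 4        ≡⟨ solve 2 (λ c n → c :* n :^ 4 := c :* n :^ 3 :* n) refl 144 n ⟩
    144 * n ^ 3 * n    ≤⟨ *-monoˡ-≤ n (*-monoʳ-≤ 144 (n³≤15m {n} {m} 16<n n⁶≤)) ⟩
    144 * (15 * m) * n ≡⟨ cong (_* n) (sym (*-assoc 144 15 m)) ⟩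
    2160 * m * n       ≤⟨ *-monoˡ-≤ n (*-monoˡ-≤ m (m≤m+n 2160 2160)) ⟩
    4320 * m * n       ∎
  quartic : 144 * n ^ 4 ≤ 4320 * m * n + 43200 * n ^ 2
  quartic = [ (λ n≤16 → ≤-trans (144n⁴≤43200n² n≤16) (m≤n+m (43200 * n ^ 2) (4320 * m * n)))
            , (λ 16<n → ≤-trans (large 16<n) (m≤m+n (4320 * m * n) (43200 * n ^ 2)))
            ]′ (≤-<-connex n 16)

-- Since 2x(x+q) = (n² − q²)/2, the bounds say 3q² ≤ n² ≤ 3q² + 12n.
record BalancedSplit (n : ℕ) : Set where
  field
    x q            : ℕ
    n≡             : n ≡ x + (x + q)
    1≤x            : 1 ≤ x
    q²≤2x[x+q]     : q ^ 2 ≤ 2 * x * (x + q)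
    2x[x+q]≤q²+6n : 2 * x * (x + q) ≤ q ^ 2 + 6 * n

-- Passing from (x, q + 2) to (x + 1, q) keeps n and raises 2x(x+q) − q² by 6(q + 1) ≤ 6n,
-- so the first step at which it becomes nonnegative yields a balanced split.
balancedSplit-search : ∀ {n} x q → n ≡ x + (x + q) → 2 ≤ n → 2 * x * (x + q) < q ^ 2 → BalancedSplit n
balancedSplit-search x       zero          _    _        ()
balancedSplit-search zero    (suc zero)    refl (s≤s ()) _
balancedSplit-search (suc x) (suc zero)    _    _        (s≤s ())
balancedSplit-search {n} x   (suc (suc q)) n≡   2≤n      a<b = step (q ^ 2 ≤? a′)
  where
  a′ = 2 * suc x * (suc x + q)
  n≡′ : n ≡ suc x + (suc x + q)
  n≡′ = trans n≡ (solve 2 (λ x q → x :+ (x :+ (con 2 :+ q)) := (con 1 :+ x) :+ ((con 1 :+ x) :+ q)) refl x q)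
  1+q≤n : suc q ≤ n
  1+q≤n = ≤-trans (n≤1+n (suc q)) (≤-trans (m≤n+m _ x) (≤-trans (m≤n+m _ x) (≤-reflexive (sym n≡))))
  a′≤ : a′ ≤ q ^ 2 + 6 * n
  a′≤ = ≤-trans (+-cancelˡ-≤ (suc (suc q) ^ 2) _ _ (begin
    suc (suc q) ^ 2 + a′                           ≡⟨ exchange x q ⟩
    2 * x * (x + suc (suc q)) + (q ^ 2 + 6 * suc q) ≤⟨ +-monoˡ-≤ _ (<⇒≤ a<b) ⟩
    suc (suc q) ^ 2 + (q ^ 2 + 6 * suc q)          ∎)) (+-monoʳ-≤ (q ^ 2) (*-monoʳ-≤ 6 1+q≤n))
    where
    open ≤-Reasoning
    exchange : ∀ x q → suc (suc q) ^ 2 + 2 * suc x * (suc x + q) ≡ 2 * x * (x + suc (suc q)) + (q ^ 2 + 6 * suc q)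
    exchange = solve 2 (λ x q → (con 2 :+ q) :^ 2 :+ con 2 :* (con 1 :+ x) :* ((con 1 :+ x) :+ q)
                              := con 2 :* x :* (x :+ (con 2 :+ q)) :+ (q :^ 2 :+ con 6 :* (con 1 :+ q))) refl
  step : Dec (q ^ 2 ≤ a′) → BalancedSplit n
  step (yes b′≤a′) = record { x = suc x ; q = q ; n≡ = n≡′ ; 1≤x = s≤s z≤n ; q²≤2x[x+q] = b′≤a′ ; 2x[x+q]≤q²+6n = a′≤ }
  step (no  b′≰a′) = balancedSplit-search (suc x) q n≡′ 2≤n (≰⇒> b′≰a′)

balancedSplit : ∀ n → 2 ≤ n → BalancedSplit n
balancedSplit n 2≤n@(s≤s (s≤s _)) = balancedSplit-search 0 n refl 2≤n (s≤s z≤n)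

maxOver : ∀ {A : Set} → (A → ℕ) → List A → ℕ
maxOver f xs = foldr _⊔_ 0 (map f xs)

maxOver-elim : ∀ {A : Set} (P : ℕ → Set) {f : A → ℕ} {xs} →
  P 0 → (∀ {x} → x ∈ xs → P (f x)) → P (maxOver f xs)
maxOver-elim P {f} {xs} P0 Pf with foldr-selective ⊔-sel 0 (map f xs)
... | inj₁ max≡0 = subst P (sym max≡0) P0
... | inj₂ max∈ with x , x∈ , max≡ ← ∈-map⁻ f max∈ = subst P (sym max≡) (Pf x∈)

≤-maxOver : ∀ {A : Set} (f : A → ℕ) {xs x} → x ∈ xs → f x ≤ maxOver f xs
≤-maxOver f {xs} x∈ = All.lookup (foldr-forcesᵇ split 0 (map f xs) ≤-refl) (∈-map⁺ f x∈)
  where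
  split : ∀ a b → a ⊔ b ≤ maxOver f xs → a ≤ maxOver f xs × b ≤ maxOver f xs
  split a b a⊔b≤ = m⊔n≤o⇒m≤o a b a⊔b≤ , m⊔n≤o⇒n≤o a b a⊔b≤

∈-range⁻ : ∀ {n x} → x ∈ map suc (upTo (n ∸ 1)) → x ≤ n
∈-range⁻ {n} x∈ with i , i∈ , refl ← ∈-map⁻ suc x∈ = ≤-trans (∈-upTo⁻ i∈) (m∸n≤m n 1)

∈-range⁺ : ∀ {n x} → 1 ≤ x → x < n → x ∈ map suc (upTo (n ∸ 1))
∈-range⁺ {suc n} (s≤s z≤n) (s≤s x<n) = ∈-map⁺ suc (∈-upTo⁺ x<n)

maxMoBipartite-upper : ∀ n → 108 * maxMoBipartite n ^ 2 ≤ n ^ 6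
maxMoBipartite-upper n = maxOver-elim (λ M → 108 * M ^ 2 ≤ n ^ 6) z≤n (λ x∈ → bound (∈-range⁻ x∈))
  where
  open ≤-Reasoning
  bound : ∀ {x} → x ≤ n → 108 * mostar (completeBipartite n x) ^ 2 ≤ n ^ 6
  bound {x} x≤n = begin
    108 * mostar (completeBipartite n x) ^ 2 ≡⟨ cong (λ M → 108 * M ^ 2) (mostar-completeBipartite n x x≤n) ⟩
    108 * mostarK (n ∸ x) x ^ 2              ≤⟨ mostarK-bound (n ∸ x) x ⟩
    (n ∸ x + x) ^ 6                          ≡⟨ cong (_^ 6) (m∸n+n≡m x≤n) ⟩
    n ^ 6                                    ∎

maxMoBipartite-lower : ∀ n → 2 ≤ n → n ^ 6 ≤ 108 * (maxMoBipartite n + 20 * n) ^ 2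
maxMoBipartite-lower n 2≤n with balancedSplit n 2≤n
... | record { x = x ; q = q ; n≡ = refl ; 1≤x = 1≤x ; q²≤2x[x+q] = lower ; 2x[x+q]≤q²+6n = upper } = begin
  n ^ 6                                ≤⟨ n⁶≤[m+20n]² n M (balanced-bound x q lower upper) ⟩
  108 * (M + 20 * n) ^ 2               ≤⟨ *-monoʳ-≤ 108 (^-monoˡ-≤ 2 (+-monoˡ-≤ (20 * n) M≤max)) ⟩
  108 * (maxMoBipartite n + 20 * n) ^ 2 ∎
  where
  open ≤-Reasoning
  M = q * (x * (x + q))
  Mo≡M : mostar (completeBipartite n x) ≡ M
  Mo≡M = begin-equality
    mostar (completeBipartite n x) ≡⟨ mostar-completeBipartite n x (m≤m+n x (x + q)) ⟩
    mostarK (n ∸ x) x              ≡⟨ cong (λ y → mostarK y x) (m+n∸m≡n x (x + q)) ⟩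
    mostarK (x + q) x              ≡⟨ mostarK-split x q ⟩
    M                              ∎
  M≤max : M ≤ maxMoBipartite n
  M≤max = subst (_≤ maxMoBipartite n) Mo≡M
    (≤-maxOver (λ y → mostar (completeBipartite n y)) (∈-range⁺ 1≤x (m<m+n x (≤-trans 1≤x (m≤m+n x q)))))

mainTheorem1 : ∃[ C ] ((n : ℕ) → 2 ≤ n →
    (n ^ 6 ≤ 108 * (maxMoBipartite n + C * n) ^ 2)
    × (108 * (maxMoBipartite n ∸ C * n) ^ 2 ≤ n ^ 6))
mainTheorem1 = 20 , λ n 2≤n →
    maxMoBipartite-lower n 2≤n
  , ≤-trans (*-monoʳ-≤ 108 (^-monoˡ-≤ 2 (m∸n≤m (maxMoBipartite n) (20 * n)))) (maxMoBipartite-upper n)
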